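{- Let $\sigma$ be a signature. Every instance of $\forall x\Box\Phi\rightarrow\Box\forall x\Phi$ belongs to $\mathsf{QBK}^\sharp_\sigma$, and every instance of $\Diamond\exists x\Phi\rightarrow\exists x\Diamond\Phi$ belongs to $\mathsf{QBK}^\sharp_{\mathtt{Ba}^\Box,\sigma}$. (Hence $\mathsf{QBK}^\sharp_\sigma=\mathsf{QBK}^\sharp_{\mathtt{Ba}^\Box,\sigma}$.)
   Context: Signature $\sigma$: predicate symbols (with arities) and constants, no function symbols. $\sigma$-formulas are built from atomic formulas and $\bot$ by $\rightarrow,\wedge,\vee$, strong negation $\sim$, $\Box,\Diamond$, $\forall x,\exists x$. Abbreviations: $\neg\Phi:=\Phi\rightarrow\bot$, $\Phi\leftrightarrow\Psi:=(\Phi\rightarrow\Psi)\wedge(\Psi\rightarrow\Phi)$, $\Phi\Leftrightarrow\Psi:=(\Phi\leftrightarrow\Psi)\wedge({\sim\Phi}\leftrightarrow{\sim\Psi})$; $\Phi(x/t)$ is substitution. $\mathsf{QBK}_\sigma$ is the smallest set of $\sigma$-formulas containing all instances of: $\Phi\rightarrow(\Psi\rightarrow\Phi)$; $(\Phi\rightarrow(\Psi\rightarrow\Theta))\rightarrow((\Phi\rightarrow\Psi)\rightarrow(\Phi\rightarrow\Theta))$; $\Phi\wedge\Psi\rightarrow\Phi$; $\Phi\wedge\Psi\rightarrow\Psi$; $\Phi\rightarrow(\Psi\rightarrow\Phi\wedge\Psi)$; $\Phi\rightarrow\Phi\vee\Psi$; $\Psi\rightarrow\Phi\vee\Psi$;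 $(\Phi\rightarrow\Theta)\rightarrow((\Psi\rightarrow\Theta)\rightarrow(\Phi\vee\Psi\rightarrow\Theta))$; $\Phi\vee(\Phi\rightarrow\bot)$; $\bot\rightarrow\Phi$; ${\sim\sim\Phi}\leftrightarrow\Phi$; ${\sim(\Phi\rightarrow\Psi)}\leftrightarrow(\Phi\wedge{\sim\Psi})$; ${\sim(\Phi\vee\Psi)}\leftrightarrow({\sim\Phi}\wedge{\sim\Psi})$; ${\sim(\Phi\wedge\Psi)}\leftrightarrow({\sim\Phi}\vee{\sim\Psi})$; ${\sim\bot}$; $(\Box\Phi\wedge\Box\Psi)\rightarrow\Box(\Phi\wedge\Psi)$; $\Box(\Phi\rightarrow\Phi)$; $\neg\Box\Phi\leftrightarrow\Diamond\neg\Phi$; $\neg\Diamond\Phi\leftrightarrow\Box\neg\Phi$; $\Box\Phi\Leftrightarrow{\sim\Diamond{\sim\Phi}}$; $\Diamond\Phi\Leftrightarrow{\sim\Box{\sim\Phi}}$; $\forall x\Phi\rightarrow\Phi(x/t)$, $\Phi(x/t)\rightarrow\exists x\Phi$ ($t$ free for $x$ in $\Phi$); ${\sim\forall x\Phi}\leftrightarrow\exists x{\sim\Phi}$; ${\sim\exists x\Phi}\leftrightarrow\forall x{\sim\Phi}$; and closed under MP (from $\Phi,\Phi\rightarrow\Psi$ infer $\Psi$), MB (from $\Phi\rightarrow\Psi$ infer $\Box\Phi\rightarrow\Box\Psi$), MD (from $\Phi\rightarrow\Psi$ infer $\Diamond\Phi\rightarrow\Diamond\Psi$), BR1 (from $\Phi\rightarrow\Psi$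 infer $\Phi\rightarrow\forall x\Psi$, $x$ not free in $\Phi$), BR2 (from $\Phi\rightarrow\Psi$ infer $\exists x\Phi\rightarrow\Psi$, $x$ not free in $\Psi$). $\mathsf{QBK}^\sharp_\sigma$ is the smallest set of $\sigma$-formulas containing the axioms of $\mathsf{QBK}_\sigma$ and all instances of $\mathtt{Ba}:=\Diamond\exists x\Phi\rightarrow\exists x\Diamond\Phi$, closed under MP, MB, MD, BR1, BR2. $\mathsf{QBK}^\sharp_{\mathtt{Ba}^\Box,\sigma}$ is defined in the same way with the scheme $\mathtt{Ba}^\Box:=\forall x\Box\Phi\rightarrow\Box\forall x\Phi$ instead of $\mathtt{Ba}$. -}

module Defs where

open import Data.Nat using (ℕ; _≟_)
open import Data.Vec using (Vec)
open import Data.Vec.Relation.Unary.Any using (Any)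
open import Data.Vec using (map)
open import Data.Product using (_×_)
open import Data.Unit using (⊤)
open import Data.Empty using (⊥)
open import Relation.Nullary using (¬_; yes; no)
open import Relation.Binary.PropositionalEquality using (_≡_; _≢_)

record Signature : Set₁ where
  field
    Pred  : Set
    arity : Pred → ℕ
    Const : Set

module Syntax (σ : Signature) where
  open Signature σ

  data Term : Set where
    var : ℕ → Term
    con : Const → Term

  infixr 5 _⇒_
  infixr 6 _∨'_
  infixr 7 _∧'_

  data Form : Set where
    atom : (P : Pred) → Vec Term (arity P) → Form
    ⊥'   : Form
    _⇒_  : Form → Form → Form
    _∧'_ : Form → Form → Form
    _∨'_ : Form → Form → Form
    ∼_   : Form → Form
    □_   : Form → Form
    ◇_   : Form → Form
    ∀'   : ℕ → Form → Form
    ∃'   : ℕ → Form → Form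

  ¬'_ : Form → Form
  ¬' φ = φ ⇒ ⊥'

  _⇔_ : Form → Form → Form
  φ ⇔ ψ = (φ ⇒ ψ) ∧' (ψ ⇒ φ)

  _⇔⇔_ : Form → Form → Form
  φ ⇔⇔ ψ = (φ ⇔ ψ) ∧' ((∼ φ) ⇔ (∼ ψ))

  FreeIn : ℕ → Form → Set
  FreeIn x (atom P ts) = Any (λ t → t ≡ var x) ts
  FreeIn x ⊥'        = ⊥
  FreeIn x (φ ⇒ ψ)   = FreeIn x φ Data.Sum.⊎ FreeIn x ψ
    where import Data.Sum
  FreeIn x (φ ∧' ψ)  = FreeIn x φ Data.Sum.⊎ FreeIn x ψ
    where import Data.Sum
  FreeIn x (φ ∨' ψ)  = FreeIn x φ Data.Sum.⊎ FreeIn x ψ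
    where import Data.Sum
  FreeIn x (∼ φ)     = FreeIn x φ
  FreeIn x (□ φ)     = FreeIn x φ
  FreeIn x (◇ φ)     = FreeIn x φ
  FreeIn x (∀' y φ)  = (y ≢ x) × FreeIn x φ
  FreeIn x (∃' y φ)  = (y ≢ x) × FreeIn x φ

  VarOf : ℕ → Term → Set
  VarOf y (var z) = z ≡ y
  VarOf y (con c) = ⊥

  substT : ℕ → Term → Term → Term
  substT x t (var z) with z ≟ x
  ... | yes _ = t
  ... | no  _ = var z
  substT x t (con c) = con c

  -- φ(x/t): replace the free occurrences of x in φ by t (no renaming)
  subst : ℕ → Term → Form → Form
  subst x t (atom P ts) = atom P (map (substT x t) ts)
  subst x t ⊥'         = ⊥'
  subst x t (φ ⇒ ψ)    = subst x t φ ⇒ subst x t ψ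
  subst x t (φ ∧' ψ)   = subst x t φ ∧' subst x t ψ
  subst x t (φ ∨' ψ)   = subst x t φ ∨' subst x t ψ
  subst x t (∼ φ)      = ∼ subst x t φ
  subst x t (□ φ)      = □ subst x t φ
  subst x t (◇ φ)      = ◇ subst x t φ
  subst x t (∀' y φ) with y ≟ x
  ... | yes _ = ∀' y φ
  ... | no  _ = ∀' y (subst x t φ)
  subst x t (∃' y φ) with y ≟ x
  ... | yes _ = ∃' y φ
  ... | no  _ = ∃' y (subst x t φ)

  FreeFor : Term → ℕ → Form → Set
  FreeFor t x (atom P ts) = ⊤
  FreeFor t x ⊥'        = ⊤
  FreeFor t x (φ ⇒ ψ)   = FreeFor t x φ × FreeFor t x ψ
  FreeFor t x (φ ∧' ψ)  = FreeFor t x φ × FreeFor t x ψ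
  FreeFor t x (φ ∨' ψ)  = FreeFor t x φ × FreeFor t x ψ
  FreeFor t x (∼ φ)     = FreeFor t x φ
  FreeFor t x (□ φ)     = FreeFor t x φ
  FreeFor t x (◇ φ)     = FreeFor t x φ
  FreeFor t x (∀' y φ) with y ≟ x
  ... | yes _ = ⊤
  ... | no  _ = (FreeIn x φ → ¬ VarOf y t) × FreeFor t x φ
  FreeFor t x (∃' y φ) with y ≟ x
  ... | yes _ = ⊤
  ... | no  _ = (FreeIn x φ → ¬ VarOf y t) × FreeFor t x φ

  Ba : ℕ → Form → Form
  Ba x φ = ◇ (∃' x φ) ⇒ ∃' x (◇ φ)

  Ba□ : ℕ → Form → Form
  Ba□ x φ = ∀' x (□ φ) ⇒ □ (∀' x φ)

  -- QBK_σ extended by an extra axiom scheme `extra` (instances extra x Φ),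
  -- closed under MP, MB, MD, BR1, BR2.
  data Thm (extra : ℕ → Form → Form) : Form → Set where
    ax-K    : ∀ φ ψ → Thm extra (φ ⇒ (ψ ⇒ φ))
    ax-S    : ∀ φ ψ θ → Thm extra ((φ ⇒ (ψ ⇒ θ)) ⇒ ((φ ⇒ ψ) ⇒ (φ ⇒ θ)))
    ax-∧₁   : ∀ φ ψ → Thm extra (φ ∧' ψ ⇒ φ)
    ax-∧₂   : ∀ φ ψ → Thm extra (φ ∧' ψ ⇒ ψ)
    ax-∧I   : ∀ φ ψ → Thm extra (φ ⇒ (ψ ⇒ φ ∧' ψ))
    ax-∨₁   : ∀ φ ψ → Thm extra (φ ⇒ φ ∨' ψ)
    ax-∨₂   : ∀ φ ψ → Thm extra (ψ ⇒ φ ∨' ψ)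
    ax-∨E   : ∀ φ ψ θ → Thm extra ((φ ⇒ θ) ⇒ ((ψ ⇒ θ) ⇒ (φ ∨' ψ ⇒ θ)))
    ax-LEM  : ∀ φ → Thm extra (φ ∨' (φ ⇒ ⊥'))
    ax-⊥    : ∀ φ → Thm extra (⊥' ⇒ φ)
    ax-∼∼   : ∀ φ → Thm extra ((∼ (∼ φ)) ⇔ φ)
    ax-∼⇒   : ∀ φ ψ → Thm extra ((∼ (φ ⇒ ψ)) ⇔ (φ ∧' (∼ ψ)))
    ax-∼∨   : ∀ φ ψ → Thm extra ((∼ (φ ∨' ψ)) ⇔ ((∼ φ) ∧' (∼ ψ)))
    ax-∼∧   : ∀ φ ψ → Thm extra ((∼ (φ ∧' ψ)) ⇔ ((∼ φ) ∨' (∼ ψ)))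
    ax-∼⊥   : Thm extra (∼ ⊥')
    ax-□∧   : ∀ φ ψ → Thm extra ((□ φ) ∧' (□ ψ) ⇒ □ (φ ∧' ψ))
    ax-□id  : ∀ φ → Thm extra (□ (φ ⇒ φ))
    ax-¬□   : ∀ φ → Thm extra ((¬' (□ φ)) ⇔ (◇ (¬' φ)))
    ax-¬◇   : ∀ φ → Thm extra ((¬' (◇ φ)) ⇔ (□ (¬' φ)))
    ax-□∼◇  : ∀ φ → Thm extra ((□ φ) ⇔⇔ (∼ (◇ (∼ φ))))
    ax-◇∼□  : ∀ φ → Thm extra ((◇ φ) ⇔⇔ (∼ (□ (∼ φ))))
    ax-∀E   : ∀ x t φ → FreeFor t x φ → Thm extra (∀' x φ ⇒ subst x t φ)
    ax-∃I   : ∀ x t φ → FreeFor t x φ → Thm extra (subst x t φ ⇒ ∃' x φ)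
    ax-∼∀   : ∀ x φ → Thm extra ((∼ (∀' x φ)) ⇔ (∃' x (∼ φ)))
    ax-∼∃   : ∀ x φ → Thm extra ((∼ (∃' x φ)) ⇔ (∀' x (∼ φ)))
    ax-extra : ∀ x φ → Thm extra (extra x φ)
    MP  : ∀ {φ ψ} → Thm extra φ → Thm extra (φ ⇒ ψ) → Thm extra ψ
    MB  : ∀ {φ ψ} → Thm extra (φ ⇒ ψ) → Thm extra (□ φ ⇒ □ ψ)
    MD  : ∀ {φ ψ} → Thm extra (φ ⇒ ψ) → Thm extra (◇ φ ⇒ ◇ ψ)
    BR1 : ∀ {φ ψ} x → ¬ FreeIn x φ → Thm extra (φ ⇒ ψ) → Thm extra (φ ⇒ ∀' x ψ)
    BR2 : ∀ {φ ψ} x → ¬ FreeIn x ψ → Thm extra (φ ⇒ ψ) → Thm extra (∃' x φ ⇒ ψ)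

  QBK♯ : Form → Set
  QBK♯ = Thm Ba

  QBK♯Ba□ : Form → Set
  QBK♯Ba□ = Thm Ba□

{-# OPTIONS --safe #-}
module Submission where

open import Defs
open import Data.Nat using (ℕ; _≟_)
open import Data.Product using (_×_; _,_)
open import Data.Sum using (inj₁)
open import Data.Unit using (tt)
open import Data.List using (List; []; _∷_)
open import Data.List.Membership.Propositional using (_∈_)
open import Data.List.Relation.Unary.Any using (here; there)
open import Data.Vec.Properties using (map-cong; map-id)
open import Relation.Nullary using (¬_; yes; no)
open import Relation.Binary.PropositionalEquality as ≡ using (_≡_; refl; sym; trans; cong; cong₂)

-- Classically, ¬□ ↔ ◇¬, ¬◇ ↔ □¬, ¬∀ ↔ ∃¬ and ¬∃ ↔ ∀¬, so the contrapositive
-- ¬□∀xφ → ¬∀x□φ of Ba□ unfolds to ◇∃x¬φ → ∃x◇¬φ, an instance of Ba; dually the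
-- contrapositive ¬∃x◇φ → ¬◇∃xφ of Ba unfolds to ∀x□¬φ → □∀x¬φ, an instance of Ba□.

module Variables (σ : Signature) where
  open Syntax σ

  substT-var-self : ∀ x t → substT x (var x) t ≡ t
  substT-var-self x (var z) with z ≟ x
  ... | yes z≡x = cong var (sym z≡x)
  ... | no  _   = refl
  substT-var-self x (con c) = refl

  subst-var-self : ∀ x φ → subst x (var x) φ ≡ φ
  subst-var-self x (atom P ts) = cong (atom P) (trans (map-cong (substT-var-self x) ts) (map-id ts))
  subst-var-self x ⊥'       = refl
  subst-var-self x (φ ⇒ ψ)  = cong₂ _⇒_ (subst-var-self x φ) (subst-var-self x ψ)
  subst-var-self x (φ ∧' ψ) = cong₂ _∧'_ (subst-var-self x φ) (subst-var-self x ψ)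
  subst-var-self x (φ ∨' ψ) = cong₂ _∨'_ (subst-var-self x φ) (subst-var-self x ψ)
  subst-var-self x (∼ φ)    = cong ∼_ (subst-var-self x φ)
  subst-var-self x (□ φ)    = cong □_ (subst-var-self x φ)
  subst-var-self x (◇ φ)    = cong ◇_ (subst-var-self x φ)
  subst-var-self x (∀' y φ) with y ≟ x
  ... | yes _ = refl
  ... | no  _ = cong (∀' y) (subst-var-self x φ)
  subst-var-self x (∃' y φ) with y ≟ x
  ... | yes _ = refl
  ... | no  _ = cong (∃' y) (subst-var-self x φ)

  var-freeFor-self : ∀ x φ → FreeFor (var x) x φ
  var-freeFor-self x (atom P ts) = tt
  var-freeFor-self x ⊥'       = tt
  var-freeFor-self x (φ ⇒ ψ)  = var-freeFor-self x φ , var-freeFor-self x ψ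
  var-freeFor-self x (φ ∧' ψ) = var-freeFor-self x φ , var-freeFor-self x ψ
  var-freeFor-self x (φ ∨' ψ) = var-freeFor-self x φ , var-freeFor-self x ψ
  var-freeFor-self x (∼ φ)    = var-freeFor-self x φ
  var-freeFor-self x (□ φ)    = var-freeFor-self x φ
  var-freeFor-self x (◇ φ)    = var-freeFor-self x φ
  var-freeFor-self x (∀' y φ) with y ≟ x
  ... | yes _   = tt
  ... | no  y≢x = (λ _ x≡y → y≢x (sym x≡y)) , var-freeFor-self x φ
  var-freeFor-self x (∃' y φ) with y ≟ x
  ... | yes _   = tt
  ... | no  y≢x = (λ _ x≡y → y≢x (sym x≡y)) , var-freeFor-self x φ

  ∀-notFree : ∀ x φ → ¬ FreeIn x (∀' x φ)
  ∀-notFree x φ (x≢x , _) = x≢x refl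

  ∃-notFree : ∀ x φ → ¬ FreeIn x (∃' x φ)
  ∃-notFree x φ (x≢x , _) = x≢x refl

  ¬∀-notFree : ∀ x φ → ¬ FreeIn x (¬' ∀' x φ)
  ¬∀-notFree x φ (inj₁ x∈∀xφ) = ∀-notFree x φ x∈∀xφ

  ¬∃-notFree : ∀ x φ → ¬ FreeIn x (¬' ∃' x φ)
  ¬∃-notFree x φ (inj₁ x∈∃xφ) = ∃-notFree x φ x∈∃xφ

module Calculus (σ : Signature) {extra : ℕ → Syntax.Form σ → Syntax.Form σ} where
  open Syntax σ
  open Variables σ

  infix 3 ⊢_ _⊢_
  infixl 4 _⨾_

  ⊢_ : Form → Set
  ⊢_ = Thm extra

  -- Only MP acts on hypotheses (MB, MD, BR1, BR2 stay inside ⊢_), so the deduction theorem holds.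
  data _⊢_ (Γ : List Form) : Form → Set where
    hyp : ∀ {φ} → φ ∈ Γ → Γ ⊢ φ
    thm : ∀ {φ} → ⊢ φ → Γ ⊢ φ
    mp  : ∀ {φ ψ} → Γ ⊢ φ → Γ ⊢ φ ⇒ ψ → Γ ⊢ ψ

  ⇔-to : ∀ {φ ψ} → ⊢ φ ⇔ ψ → ⊢ φ ⇒ ψ
  ⇔-to φ⇔ψ = MP φ⇔ψ (ax-∧₁ _ _)

  ⇔-from : ∀ {φ ψ} → ⊢ φ ⇔ ψ → ⊢ ψ ⇒ φ
  ⇔-from φ⇔ψ = MP φ⇔ψ (ax-∧₂ _ _)

  ⇒-refl : ∀ φ → ⊢ φ ⇒ φ
  ⇒-refl φ = MP (ax-K φ φ) (MP (ax-K φ (φ ⇒ φ)) (ax-S φ (φ ⇒ φ) φ))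

  ⇒-intro : ∀ {Γ φ ψ} → φ ∷ Γ ⊢ ψ → Γ ⊢ φ ⇒ ψ
  ⇒-intro {φ = φ} (hyp (here refl)) = thm (⇒-refl φ)
  ⇒-intro {φ = φ} (hyp (there ψ∈Γ)) = mp (hyp ψ∈Γ) (thm (ax-K _ φ))
  ⇒-intro {φ = φ} (thm ⊢ψ)          = mp (thm ⊢ψ) (thm (ax-K _ φ))
  ⇒-intro {φ = φ} (mp {ψ} {θ} d e)  = mp (⇒-intro d) (mp (⇒-intro e) (thm (ax-S φ ψ θ)))

  discharge : ∀ {φ} → [] ⊢ φ → ⊢ φ
  discharge (hyp ())
  discharge (thm ⊢φ) = ⊢φ
  discharge (mp d e) = MP (discharge d) (discharge e)

  apply : ∀ {Γ φ ψ} → ⊢ φ ⇒ ψ → Γ ⊢ φ → Γ ⊢ ψ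
  apply ⊢φ⇒ψ d = mp d (thm ⊢φ⇒ψ)

  #0 : ∀ {Γ φ} → φ ∷ Γ ⊢ φ
  #0 = hyp (here refl)

  #1 : ∀ {Γ φ ψ} → ψ ∷ φ ∷ Γ ⊢ φ
  #1 = hyp (there (here refl))

  _⨾_ : ∀ {φ ψ θ} → ⊢ φ ⇒ ψ → ⊢ ψ ⇒ θ → ⊢ φ ⇒ θ
  f ⨾ g = discharge (⇒-intro (apply g (apply f #0)))

  ¬¬-elim : ∀ φ → ⊢ ¬' ¬' φ ⇒ φ
  ¬¬-elim φ = discharge (⇒-intro (mp (thm (ax-LEM φ))
    (mp (⇒-intro (apply (ax-⊥ φ) (mp #0 #1)))
      (mp (thm (⇒-refl φ)) (thm (ax-∨E φ (¬' φ) φ))))))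

  contraposition : ∀ {φ ψ} → ⊢ φ ⇒ ψ → ⊢ ¬' ψ ⇒ ¬' φ
  contraposition φ⇒ψ = discharge (⇒-intro (⇒-intro (mp (apply φ⇒ψ #0) #1)))

  ¬-swap : ∀ {φ ψ} → ⊢ φ ⇒ ¬' ψ → ⊢ ψ ⇒ ¬' φ
  ¬-swap φ⇒¬ψ = discharge (⇒-intro (⇒-intro (mp #1 (apply φ⇒¬ψ #0))))

  contraposition⁻ : ∀ {φ ψ} → ⊢ ¬' φ ⇒ ¬' ψ → ⊢ ψ ⇒ φ
  contraposition⁻ {φ} ¬φ⇒¬ψ = ¬-swap ¬φ⇒¬ψ ⨾ ¬¬-elim φ

  ∀-elim-self : ∀ x φ → ⊢ ∀' x φ ⇒ φ
  ∀-elim-self x φ = ≡.subst (λ ψ → ⊢ ∀' x φ ⇒ ψ) (subst-var-self x φ)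
    (ax-∀E x (var x) φ (var-freeFor-self x φ))

  ∃-intro-self : ∀ x φ → ⊢ φ ⇒ ∃' x φ
  ∃-intro-self x φ = ≡.subst (λ ψ → ⊢ ψ ⇒ ∃' x φ) (subst-var-self x φ)
    (ax-∃I x (var x) φ (var-freeFor-self x φ))

  ∀-mono : ∀ x {φ ψ} → ⊢ φ ⇒ ψ → ⊢ ∀' x φ ⇒ ∀' x ψ
  ∀-mono x {φ} φ⇒ψ = BR1 x (∀-notFree x φ) (∀-elim-self x φ ⨾ φ⇒ψ)

  ∃-mono : ∀ x {φ ψ} → ⊢ φ ⇒ ψ → ⊢ ∃' x φ ⇒ ∃' x ψ
  ∃-mono x {ψ = ψ} φ⇒ψ = BR2 x (∃-notFree x ψ) (φ⇒ψ ⨾ ∃-intro-self x ψ)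

  ¬∃⇒∀¬ : ∀ x φ → ⊢ ¬' ∃' x φ ⇒ ∀' x (¬' φ)
  ¬∃⇒∀¬ x φ = BR1 x (¬∃-notFree x φ) (contraposition (∃-intro-self x φ))

  ∃¬⇒¬∀ : ∀ x φ → ⊢ ∃' x (¬' φ) ⇒ ¬' ∀' x φ
  ∃¬⇒¬∀ x φ = BR2 x (¬∀-notFree x φ) (contraposition (∀-elim-self x φ))

  ∀¬⇒¬∃ : ∀ x φ → ⊢ ∀' x (¬' φ) ⇒ ¬' ∃' x φ
  ∀¬⇒¬∃ x φ = ¬-swap (BR2 x (¬∀-notFree x (¬' φ)) (¬-swap (∀-elim-self x (¬' φ))))

  ¬∀⇒∃¬ : ∀ x φ → ⊢ ¬' ∀' x φ ⇒ ∃' x (¬' φ)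
  ¬∀⇒∃¬ x φ = contraposition ¬∃¬⇒∀ ⨾ ¬¬-elim (∃' x (¬' φ))
    where
      ¬∃¬⇒∀ : ⊢ ¬' ∃' x (¬' φ) ⇒ ∀' x φ
      ¬∃¬⇒∀ = BR1 x (¬∃-notFree x (¬' φ))
        (contraposition (∃-intro-self x (¬' φ)) ⨾ ¬¬-elim φ)

module _ (σ : Signature) where
  open Syntax σ
  open Calculus σ

  Ba⇒Ba□ : ∀ x φ → QBK♯ (Ba□ x φ)
  Ba⇒Ba□ x φ = contraposition⁻
    ( ⇔-to (ax-¬□ (∀' x φ))
    ⨾ MD (¬∀⇒∃¬ x φ)
    ⨾ ax-extra x (¬' φ)
    ⨾ ∃-mono x (⇔-from (ax-¬□ φ))
    ⨾ ∃¬⇒¬∀ x (□ φ))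

  Ba□⇒Ba : ∀ x φ → QBK♯Ba□ (Ba x φ)
  Ba□⇒Ba x φ = contraposition⁻
    ( ¬∃⇒∀¬ x (◇ φ)
    ⨾ ∀-mono x (⇔-to (ax-¬◇ φ))
    ⨾ ax-extra x (¬' φ)
    ⨾ MB (∀¬⇒¬∃ x φ)
    ⨾ ⇔-from (ax-¬◇ (∃' x φ)))

proposition18 : (σ : Signature) → let open Syntax σ in
    ((x : ℕ) (φ : Form) → QBK♯ (Ba□ x φ)) × ((x : ℕ) (φ : Form) → QBK♯Ba□ (Ba x φ))
proposition18 σ = Ba⇒Ba□ σ , Ba□⇒Ba σ
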